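{- There is no strictly Deza graph $\Gamma$ with parameters $(n,k,b,a)$ such that $k=b+1$, $\beta(\Gamma)>1$, and all vertices of $\Gamma$ are of type (B).
   Context: Graphs are finite, simple, undirected. $N(v)$ is the neighbourhood of $v$. A Deza graph with parameters $(n,k,b,a)$, $b\ge a$, is a nonempty $k$-regular graph on $n$ vertices in which every pair of distinct vertices has exactly $b$ or exactly $a$ common neighbours; it is strictly Deza if it has diameter $2$ and is not strongly regular. $B(v)=\{u: |N(u)\cap N(v)|=b\}$; $\beta(\Gamma)=|B(v)|$ (independent of $v$). A vertex $v$ is of type (B) if $B(v)\subset N(v)$. -}

module Defs where

open import Data.Nat using (ℕ; zero; suc; _+_; _≤_; _<_; _≟_)
open import Data.Bool using (Bool; true; false; if_then_else_; _∧_)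
open import Data.Fin using (Fin)
open import Data.Product using (Σ; _×_; ∃; ∃-syntax)
open import Data.Sum using (_⊎_)
open import Relation.Nullary using (¬_; yes; no)
open import Relation.Binary.PropositionalEquality using (_≡_; _≢_)

count : ∀ {n} → (Fin n → Bool) → ℕ
count {zero}  f = 0
count {suc n} f = (if f Fin.zero then 1 else 0) + count (λ i → f (Fin.suc i))

record Graph (n : ℕ) : Set where
  field
    adj    : Fin n → Fin n → Bool
    sym    : ∀ u v → adj u v ≡ adj v u
    irrefl : ∀ v → adj v v ≡ false

module _ {n : ℕ} (G : Graph n) where
  open Graph G

  degree : Fin n → ℕ
  degree v = count (λ w → adj v w)

  common : Fin n → Fin n → ℕ
  common u v = count (λ w → adj u w ∧ adj v w)

  Regular : ℕ → Set
  Regular k = ∀ v → degree v ≡ k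

  IsDeza : ℕ → ℕ → ℕ → Set
  IsDeza k b a =
    (0 < n) × Regular k × (a ≤ b) ×
    (∀ u v → u ≢ v → (common u v ≡ b) ⊎ (common u v ≡ a))

  Diameter2 : Set
  Diameter2 =
    (∀ u v → u ≢ v → (adj u v ≡ true) ⊎ (∃[ w ] (adj u w ≡ true × adj w v ≡ true)))
    × (∃[ u ] ∃[ v ] (u ≢ v × adj u v ≡ false))

  IsSRG : ℕ → ℕ → ℕ → Set
  IsSRG k l m = Regular k ×
    (∀ u v → u ≢ v → (adj u v ≡ true → common u v ≡ l) × (adj u v ≡ false → common u v ≡ m))

  StronglyRegular : Set
  StronglyRegular = ∃[ k ] ∃[ l ] ∃[ m ] IsSRG k l m

  IsStrictlyDeza : ℕ → ℕ → ℕ → Set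
  IsStrictlyDeza k b a = IsDeza k b a × Diameter2 × ¬ StronglyRegular

  inB : ℕ → Fin n → Fin n → Bool
  inB b v u with common u v ≟ b
  ... | yes _ = true
  ... | no  _ = false

  βAt : ℕ → Fin n → ℕ
  βAt b v = count (inB b v)

  TypeB : ℕ → Fin n → Set
  TypeB b v = ∀ u → common u v ≡ b → adj v u ≡ true

module Submission where

-- Since k = b + 1, a vertex w ∈ B(u) (adjacent to u, u being of type (B)) shares all b
-- neighbours of u other than w itself, so u and w have the same closed neighbourhood;
-- conversely such twins have k - 1 = b common neighbours. Hence the sets {u} ∪ B(u) are the
-- classes of the twin relation. Double counting Σ_u |N(u) ∩ N(v)| = k² shows that β(v) does
-- not depend on v (given a < b, which a non-adjacent pair forces), so every class has
-- β + 1 ≥ 3 elements. Each N[p] ∩ N[q] is a union of classes, of size a for non-adjacent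
-- p, q and |N(p) ∩ N(q)| + 2 for adjacent ones; so β + 1 divides a, and an adjacent pair with
-- a common neighbours would make it divide 2. Thus Γ would be strongly regular.

open import Defs
open import Data.Nat using (ℕ; zero; suc; _+_; _*_; _∸_; _≤_; _<_; z≤n; s≤s; _<?_; >-nonZero)
import Data.Nat as ℕ
open import Data.Nat.Properties
  using ( +-*-semiring; +-comm; +-suc; +-identityʳ; +-cancelˡ-≡; +-cancelʳ-≡; *-cancelʳ-≡
        ; +-monoˡ-≤; suc-injective; m+[n∸m]≡n; m<n⇒0<n∸m; 1+n≢n; n<1+n
        ; ≤-pred; ≤-trans; <-trans; <-irrefl; m≤n⇒m≤1+n; n≤0⇒n≡0; ≮⇒≥; <⇒≤; <⇒≢; <⇒≱; ≤∧≢⇒< )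
open import Data.Nat.Divisibility using (_∣_; _∣0; ∣-refl; ∣m∣n⇒∣m+n; ∣m+n∣m⇒∣n; ∣⇒≤)
open import Data.Bool using (Bool; true; false; if_then_else_; _∧_; _∨_; not)
open import Data.Bool.Properties using (⇔→≡; ∨-identityʳ; ∧-zeroʳ; ∧-identityʳ; ∧-idem; ∧-comm)
open import Data.Fin using (Fin; _≟_)
open import Data.Product using (_×_; _,_; ∃; proj₁; proj₂)
open import Data.Sum using (_⊎_; inj₁; inj₂)
open import Function using (_⇔_; mk⇔; Equivalence; _∘_)
open import Relation.Nullary using (¬_; does; yes; no; contradiction)
open import Relation.Nullary.Decidable using (does-⇔; dec-false)
open import Relation.Binary.PropositionalEquality
  using (_≡_; _≢_; refl; sym; trans; cong; cong₂; subst; module ≡-Reasoning)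
open import Algebra.Properties.Semiring.Sum +-*-semiring
  using (sum-syntax; ∑-comm; ∑-distrib-+; sum-cong-≗; *-distribˡ-sum; *-distribʳ-sum)

indicator : Bool → ℕ
indicator b = if b then 1 else 0

indicator-∧ : ∀ x y → indicator (x ∧ y) ≡ indicator x * indicator y
indicator-∧ true  y = sym (+-identityʳ (indicator y))
indicator-∧ false y = refl

∧-true : ∀ {p q} → p ∧ q ≡ true → p ≡ true × q ≡ true
∧-true {true} {true} _ = refl , refl

count≡∑ : ∀ {n} (f : Fin n → Bool) → count f ≡ ∑[ i < n ] indicator (f i)
count≡∑ {zero}  f = refl
count≡∑ {suc n} f = cong (indicator (f Fin.zero) +_) (count≡∑ (λ i → f (Fin.suc i)))

∑-indicator : ∀ {n} (f : Fin n → Bool) c → ∑[ i < n ] (indicator (f i) * c) ≡ count f * c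
∑-indicator {n} f c = begin
  ∑[ i < n ] (indicator (f i) * c)  ≡⟨ *-distribʳ-sum c (λ i → indicator (f i)) ⟨
  (∑[ i < n ] indicator (f i)) * c  ≡⟨ cong (_* c) (count≡∑ f) ⟨
  count f * c                       ∎
  where open ≡-Reasoning

count-cong : ∀ {n} {f g : Fin n → Bool} → (∀ i → f i ≡ g i) → count f ≡ count g
count-cong {zero}  f≗g = refl
count-cong {suc n} f≗g =
  cong₂ _+_ (cong indicator (f≗g Fin.zero)) (count-cong (λ i → f≗g (Fin.suc i)))

count-false : ∀ {n} → count {n} (λ _ → false) ≡ 0
count-false {zero}  = refl
count-false {suc n} = count-false {n}

count-≟ : ∀ {n} (j : Fin n) → count (λ i → does (i ≟ j)) ≡ 1
count-≟ {suc n} Fin.zero    = cong suc (count-false {n})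
count-≟         (Fin.suc j) = count-≟ j

count-∧-split : ∀ {n} (f g : Fin n → Bool) →
  count f ≡ count (λ i → f i ∧ g i) + count (λ i → f i ∧ not (g i))
count-∧-split {zero}  f g = refl
count-∧-split {suc n} f g
  with f Fin.zero | g Fin.zero | count-∧-split (λ i → f (Fin.suc i)) (λ i → g (Fin.suc i))
... | true  | true  | ih = cong suc ih
... | true  | false | ih = trans (cong suc ih) (sym (+-suc _ _))
... | false | _     | ih = ih

count-∨-disjoint : ∀ {n} (f g : Fin n → Bool) → (∀ i → f i ≡ true → g i ≡ false) →
  count (λ i → f i ∨ g i) ≡ count f + count g
count-∨-disjoint {zero}  f g disjoint = refl
count-∨-disjoint {suc n} f g disjoint
  with f Fin.zero in f₀ | g Fin.zero in g₀
     | count-∨-disjoint (λ i → f (Fin.suc i)) (λ i → g (Fin.suc i)) (λ i → disjoint (Fin.suc i))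
... | true  | true  | _  = contradiction (trans (sym g₀) (disjoint Fin.zero f₀)) λ ()
... | true  | false | ih = cong suc ih
... | false | true  | ih = trans (cong suc ih) (sym (+-suc _ _))
... | false | false | ih = ih

count≤n : ∀ {n} (f : Fin n → Bool) → count f ≤ n
count≤n {zero}  f = z≤n
count≤n {suc n} f with f Fin.zero
... | true  = s≤s (count≤n (λ i → f (Fin.suc i)))
... | false = m≤n⇒m≤1+n (count≤n (λ i → f (Fin.suc i)))

count>0 : ∀ {n} (f : Fin n → Bool) {i} → f i ≡ true → 0 < count f
count>0 f {Fin.zero}  fi rewrite fi = s≤s z≤n
count>0 f {Fin.suc i} fi with f Fin.zero
... | true  = s≤s z≤n
... | false = count>0 (λ j → f (Fin.suc j)) fi

count>0⇒∃ : ∀ {n} (f : Fin n → Bool) → 0 < count f → ∃ λ i → f i ≡ true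
count>0⇒∃ {suc n} f pos with f Fin.zero in f₀
... | true  = Fin.zero , f₀
... | false with count>0⇒∃ (λ j → f (Fin.suc j)) pos
...   | i , fi = Fin.suc i , fi

count-⊆-≡ : ∀ {n} (f g : Fin n → Bool) → (∀ i → f i ≡ true → g i ≡ true) →
  count f ≡ count g → ∀ i → g i ≡ true → f i ≡ true
count-⊆-≡ {n} f g f⊆g |f|≡|g| i gi with f i in fi
... | true  = refl
... | false = contradiction (count>0 g∖f g∖f-i) (<-irrefl (sym |g∖f|≡0))
  where
  g∖f : Fin n → Bool
  g∖f j = g j ∧ not (f j)

  g∖f-i : g∖f i ≡ true
  g∖f-i rewrite gi | fi = refl

  g∩f≡f : ∀ j → g j ∧ f j ≡ f j
  g∩f≡f j with f j in fj
  ... | true  rewrite f⊆g j fj = refl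
  ... | false = ∧-zeroʳ (g j)

  |g∖f|≡0 : count g∖f ≡ 0
  |g∖f|≡0 = +-cancelˡ-≡ (count f) _ _ (begin
    count f + count g∖f                         ≡⟨ cong (_+ count g∖f) (count-cong g∩f≡f) ⟨
    count (λ j → g j ∧ f j) + count g∖f         ≡⟨ count-∧-split g f ⟨
    count g                                     ≡⟨ |f|≡|g| ⟨
    count f                                     ≡⟨ +-identityʳ (count f) ⟨
    count f + 0                                 ∎)
    where open ≡-Reasoning

module _ {n} (R : Fin n → Fin n → Bool) where

  Closed : (Fin n → Bool) → Set
  Closed S = ∀ {u w} → R u w ≡ true → S u ≡ S w

  count-split-class : ∀ S → Closed S → ∀ {u} → S u ≡ true →
    count S ≡ count (R u) + count (λ w → S w ∧ not (R u w))
  count-split-class S S-closed {u} Su =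
    trans (count-∧-split S (R u)) (cong (_+ count (λ w → S w ∧ not (R u w))) (count-cong S∩Ru≡Ru))
    where
    S∩Ru≡Ru : ∀ w → S w ∧ R u w ≡ R u w
    S∩Ru≡Ru w with R u w in Ruw
    ... | true  rewrite sym (S-closed Ruw) | Su = refl
    ... | false = ∧-zeroʳ (S w)

  ∣-count-closed : (∀ u → R u u ≡ true) → (∀ u → Closed (R u)) →
    ∀ {c} → (∀ u → count (R u) ≡ c) → ∀ S → Closed S → c ∣ count S
  ∣-count-closed R-refl R-closed {c} |R|≡c S = go n S (count≤n S)
    where
    go : ∀ m S → count S ≤ m → Closed S → c ∣ count S
    go zero    S |S|≤0 _ = subst (c ∣_) (sym (n≤0⇒n≡0 |S|≤0)) (c ∣0)
    go (suc m) S |S|≤1+m S-closed with 0 <? count S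
    ... | no  |S|≯0 = subst (c ∣_) (sym (n≤0⇒n≡0 (≮⇒≥ |S|≯0))) (c ∣0)
    ... | yes |S|>0 with u , Su ← count>0⇒∃ S |S|>0 =
      subst (c ∣_) (sym |S|≡c+|S′|) (∣m∣n⇒∣m+n ∣-refl (go m S′ |S′|≤m S′-closed))
      where
      S′ : Fin n → Bool
      S′ w = S w ∧ not (R u w)

      S′-closed : Closed S′
      S′-closed Rww′ = cong₂ (λ x y → x ∧ not y) (S-closed Rww′) (R-closed u Rww′)

      |S|≡c+|S′| : count S ≡ c + count S′
      |S|≡c+|S′| = trans (count-split-class S S-closed Su) (cong (_+ count S′) (|R|≡c u))

      |S′|≤m : count S′ ≤ m
      |S′|≤m = ≤-pred (≤-trans (+-monoˡ-≤ (count S′) c>0) (subst (_≤ suc m) |S|≡c+|S′| |S|≤1+m))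
        where
        c>0 : 0 < c
        c>0 = subst (0 <_) (|R|≡c u) (count>0 (R u) (R-refl u))

module GraphProperties {n} (G : Graph n) where
  open Graph G renaming (sym to adj-sym)

  N[_] : Fin n → Fin n → Bool
  N[ u ] x = does (x ≟ u) ∨ adj u x

  N[]-sym : ∀ u x → N[ u ] x ≡ N[ x ] u
  N[]-sym u x = cong₂ _∨_ (does-⇔ (mk⇔ sym sym) (x ≟ u) (u ≟ x)) (adj-sym u x)

  Twins : Fin n → Fin n → Set
  Twins u w = ∀ x → N[ u ] x ≡ N[ w ] x

  common-sym : ∀ u v → common G u v ≡ common G v u
  common-sym u v = count-cong (λ x → ∧-comm (adj u x) (adj v x))

  common-self : ∀ v → common G v v ≡ degree G v
  common-self v = count-cong (λ x → ∧-idem (adj v x))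

  inB⇔ : ∀ b v u → inB G b v u ≡ true ⇔ common G u v ≡ b
  inB⇔ b v u with common G u v ℕ.≟ b
  ... | yes c≡b = mk⇔ (λ _ → c≡b) (λ _ → refl)
  ... | no  c≢b = mk⇔ (λ ()) (λ c≡b → contradiction c≡b c≢b)

  ∑-common : ∀ {k} → Regular G k → ∀ v → ∑[ u < n ] common G u v ≡ k * k
  ∑-common {k} regular v = begin
    ∑[ u < n ] common G u v
      ≡⟨ sum-cong-≗ (λ u → count≡∑ (λ x → adj u x ∧ adj v x)) ⟩
    ∑[ u < n ] ∑[ x < n ] indicator (adj u x ∧ adj v x)
      ≡⟨ ∑-comm (λ u x → indicator (adj u x ∧ adj v x)) ⟩
    ∑[ x < n ] ∑[ u < n ] indicator (adj u x ∧ adj v x)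
      ≡⟨ sum-cong-≗ (λ x → sum-cong-≗ (split x)) ⟩
    ∑[ x < n ] ∑[ u < n ] (indicator (adj x u) * indicator (adj v x))
      ≡⟨ sum-cong-≗ (λ x → ∑-indicator (adj x) (indicator (adj v x))) ⟩
    ∑[ x < n ] (degree G x * indicator (adj v x))
      ≡⟨ sum-cong-≗ (λ x → cong (_* indicator (adj v x)) (regular x)) ⟩
    ∑[ x < n ] (k * indicator (adj v x))
      ≡⟨ *-distribˡ-sum k (λ x → indicator (adj v x)) ⟨
    k * ∑[ x < n ] indicator (adj v x)
      ≡⟨ cong (k *_) (trans (sym (count≡∑ (adj v))) (regular v)) ⟩
    k * k
      ∎
    where
    open ≡-Reasoning

    split : ∀ x u → indicator (adj u x ∧ adj v x) ≡ indicator (adj x u) * indicator (adj v x)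
    split x u = trans (indicator-∧ (adj u x) (adj v x))
                      (cong (λ y → indicator y * indicator (adj v x)) (adj-sym u x))

  degree-remove : ∀ {u w} → adj u w ≡ true →
    degree G u ≡ suc (count (λ x → adj u x ∧ not (does (x ≟ w))))
  degree-remove {u} {w} u~w =
    trans (count-∧-split (adj u) (λ x → does (x ≟ w)))
          (cong (_+ count (λ x → adj u x ∧ not (does (x ≟ w)))) (trans (count-cong at-w) (count-≟ w)))
    where
    at-w : ∀ x → adj u x ∧ does (x ≟ w) ≡ does (x ≟ w)
    at-w x with x ≟ w
    ... | yes refl = trans (∧-identityʳ (adj u x)) u~w
    ... | no  _    = ∧-zeroʳ (adj u x)

  twins⇒adj : ∀ {u w} → Twins u w → u ≢ w → adj u w ≡ true
  twins⇒adj {u} {w} twins u≢w with twins w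
  ... | N[u]w≡N[w]w with w ≟ u | w ≟ w
  ...   | yes w≡u | _       = contradiction (sym w≡u) u≢w
  ...   | no  _   | yes _   = N[u]w≡N[w]w
  ...   | no  _   | no  w≢w = contradiction refl w≢w

  twins⇒degree≡1+common : ∀ {u w} → Twins u w → u ≢ w → degree G u ≡ suc (common G w u)
  twins⇒degree≡1+common {u} {w} twins u≢w =
    trans (degree-remove (twins⇒adj twins u≢w)) (cong suc (count-cong pointwise))
    where
    pointwise : ∀ x → adj u x ∧ not (does (x ≟ w)) ≡ adj w x ∧ adj u x
    pointwise x with x ≟ w | x ≟ u | twins x
    ... | yes refl | _        | _     rewrite irrefl x = ∧-zeroʳ (adj u x)
    ... | no  _    | yes refl | _     rewrite irrefl x = sym (∧-zeroʳ (adj w x))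
    ... | no  _    | no  _    | adj≡ rewrite adj≡ = trans (∧-identityʳ (adj w x)) (sym (∧-idem (adj w x)))

  degree≡1+common⇒⊆ : ∀ {u w} → adj u w ≡ true → degree G u ≡ suc (common G w u) →
    ∀ x → adj u x ≡ true → x ≢ w → adj w x ≡ true
  degree≡1+common⇒⊆ {u} {w} u~w deg x u~x x≢w = proj₁ (∧-true (count-⊆-≡ f g f⊆g |f|≡|g| x gx))
    where
    f g : Fin n → Bool
    f y = adj w y ∧ adj u y
    g y = adj u y ∧ not (does (y ≟ w))

    f⊆g : ∀ y → f y ≡ true → g y ≡ true
    f⊆g y fy with y ≟ w
    ... | yes refl rewrite irrefl y = contradiction fy λ ()
    ... | no  _    rewrite ∧-identityʳ (adj u y) = proj₂ (∧-true fy)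

    |f|≡|g| : count f ≡ count g
    |f|≡|g| = suc-injective (trans (sym deg) (degree-remove u~w))

    gx : g x ≡ true
    gx with x ≟ w
    ... | yes x≡w = contradiction x≡w x≢w
    ... | no  _   = trans (∧-identityʳ (adj u x)) u~x

  degree≡1+common⇒twins : ∀ {u w} → adj u w ≡ true →
    degree G u ≡ suc (common G w u) → degree G w ≡ suc (common G w u) → Twins u w
  degree≡1+common⇒twins {u} {w} u~w deg-u deg-w x with x ≟ u | x ≟ w
  ... | yes refl | yes refl = refl
  ... | yes refl | no  _    = sym (trans (adj-sym w x) u~w)
  ... | no  _    | yes refl = u~w
  ... | no  x≢u  | no  x≢w  = ⇔→≡ (mk⇔ (λ u~x → degree≡1+common⇒⊆ u~w deg-u x u~x x≢w)
                                        (λ w~x → degree≡1+common⇒⊆ w~u deg-w′ x w~x x≢u))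
    where
    w~u : adj w u ≡ true
    w~u = trans (adj-sym w u) u~w
    deg-w′ : degree G w ≡ suc (common G u w)
    deg-w′ = trans deg-w (cong suc (common-sym w u))

  count-N[]∧N[] : ∀ {p q} → p ≢ q →
    count (λ x → N[ p ] x ∧ N[ q ] x) ≡ indicator (adj p q) * 2 + common G p q
  count-N[]∧N[] {p} {q} p≢q = begin
    count (λ x → N[ p ] x ∧ N[ q ] x)               ≡⟨ count-cong pointwise ⟩
    count (λ x → ends x ∨ (adj p x ∧ adj q x))      ≡⟨ count-∨-disjoint ends (λ x → adj p x ∧ adj q x) disjoint ⟩
    count ends + common G p q                       ≡⟨ cong (_+ common G p q) count-ends ⟩
    indicator (adj p q) * 2 + common G p q          ∎
    where
    open ≡-Reasoning

    ends : Fin n → Bool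
    ends x = (does (x ≟ p) ∨ does (x ≟ q)) ∧ adj p q

    pointwise : ∀ x → N[ p ] x ∧ N[ q ] x ≡ ends x ∨ (adj p x ∧ adj q x)
    pointwise x with x ≟ p | x ≟ q
    ... | yes refl | yes refl = contradiction refl p≢q
    ... | yes refl | no  _    rewrite irrefl x = trans (adj-sym q x) (sym (∨-identityʳ (adj x q)))
    ... | no  _    | yes refl rewrite irrefl x | ∧-zeroʳ (adj p x) = trans (∧-identityʳ (adj p x)) (sym (∨-identityʳ (adj p x)))
    ... | no  _    | no  _    = refl

    disjoint : ∀ x → ends x ≡ true → adj p x ∧ adj q x ≡ false
    disjoint x endx with x ≟ p | x ≟ q
    ... | yes refl | _        rewrite irrefl x = refl
    ... | no  _    | yes refl rewrite irrefl x = ∧-zeroʳ (adj p x)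
    ... | no  _    | no  _    = contradiction endx λ ()

    count-ends : count ends ≡ indicator (adj p q) * 2
    count-ends with adj p q
    ... | false = trans (count-cong (λ x → ∧-zeroʳ (does (x ≟ p) ∨ does (x ≟ q)))) (count-false {n})
    ... | true  = begin
      count (λ x → (does (x ≟ p) ∨ does (x ≟ q)) ∧ true)  ≡⟨ count-cong (λ x → ∧-identityʳ (does (x ≟ p) ∨ does (x ≟ q))) ⟩
      count (λ x → does (x ≟ p) ∨ does (x ≟ q))           ≡⟨ count-∨-disjoint (λ x → does (x ≟ p)) (λ x → does (x ≟ q)) p-not-q ⟩
      count (λ x → does (x ≟ p)) + count (λ x → does (x ≟ q)) ≡⟨ cong₂ _+_ (count-≟ p) (count-≟ q) ⟩
      2                                                   ∎
      where
      p-not-q : ∀ x → does (x ≟ p) ≡ true → does (x ≟ q) ≡ false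
      p-not-q x x≟p with x ≟ p
      ... | yes refl = dec-false (x ≟ q) p≢q

module _ {n} (G : Graph n) {k b a} (deza : IsDeza G k b a) (a<b : a < b) (b<k : b < k) where
  open GraphProperties G
  private
    regular : Regular G k
    regular = proj₁ (proj₂ deza)

    dichotomy : ∀ u v → u ≢ v → common G u v ≡ b ⊎ common G u v ≡ a
    dichotomy = proj₂ (proj₂ (proj₂ deza))

    common∈B : ∀ {u v} → inB G b v u ≡ true → common G u v ≡ b
    common∈B {u} {v} = Equivalence.to (inB⇔ b v u)

    common-self≡k : ∀ v → common G v v ≡ k
    common-self≡k v = trans (common-self v) (regular v)

  open ≡-Reasoning

  common-decomposition : ∀ u v →
    common G u v ≡ a + indicator (inB G b v u) * (b ∸ a) + indicator (does (u ≟ v)) * (k ∸ a)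
  common-decomposition u v with u ≟ v | inB G b v u in u∈Bv
  ... | yes refl | true  = contradiction (trans (sym (common∈B u∈Bv)) (common-self≡k u)) (<⇒≢ b<k)
  ... | yes refl | false = begin
    common G u u          ≡⟨ common-self≡k u ⟩
    k                     ≡⟨ m+[n∸m]≡n (<⇒≤ (<-trans a<b b<k)) ⟨
    a + (k ∸ a)           ≡⟨ cong₂ _+_ (+-identityʳ a) (+-identityʳ (k ∸ a)) ⟨
    a + 0 + (k ∸ a + 0)   ∎
  ... | no  u≢v  | true  = begin
    common G u v          ≡⟨ common∈B u∈Bv ⟩
    b                     ≡⟨ m+[n∸m]≡n (<⇒≤ a<b) ⟨
    a + (b ∸ a)           ≡⟨ trans (+-identityʳ _) (cong (a +_) (+-identityʳ (b ∸ a))) ⟨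
    a + (b ∸ a + 0) + 0   ∎
  ... | no  u≢v  | false with dichotomy u v u≢v
  ...   | inj₁ uv≡b = contradiction (trans (sym u∈Bv) (Equivalence.from (inB⇔ b v u) uv≡b)) λ ()
  ...   | inj₂ uv≡a = trans uv≡a (sym (trans (+-identityʳ (a + 0)) (+-identityʳ a)))

  ∑-common-decomposition : ∀ v →
    ∑[ u < n ] common G u v ≡ ∑[ u < n ] a + βAt G b v * (b ∸ a) + 1 * (k ∸ a)
  ∑-common-decomposition v = begin
    ∑[ u < n ] common G u v
      ≡⟨ sum-cong-≗ (λ u → common-decomposition u v) ⟩
    ∑[ u < n ] (a + indicator (inB G b v u) * (b ∸ a) + indicator (does (u ≟ v)) * (k ∸ a))
      ≡⟨ ∑-distrib-+ (λ u → a + indicator (inB G b v u) * (b ∸ a)) (λ u → indicator (does (u ≟ v)) * (k ∸ a)) ⟩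
    ∑[ u < n ] (a + indicator (inB G b v u) * (b ∸ a)) + ∑[ u < n ] (indicator (does (u ≟ v)) * (k ∸ a))
      ≡⟨ cong₂ _+_ (∑-distrib-+ (λ _ → a) (λ u → indicator (inB G b v u) * (b ∸ a))) (∑-indicator (λ u → does (u ≟ v)) (k ∸ a)) ⟩
    ∑[ u < n ] a + ∑[ u < n ] (indicator (inB G b v u) * (b ∸ a)) + count (λ u → does (u ≟ v)) * (k ∸ a)
      ≡⟨ cong₂ (λ x y → ∑[ u < n ] a + x + y * (k ∸ a)) (∑-indicator (inB G b v) (b ∸ a)) (count-≟ v) ⟩
    ∑[ u < n ] a + βAt G b v * (b ∸ a) + 1 * (k ∸ a)
      ∎

  β-constant : ∀ u v → βAt G b u ≡ βAt G b v
  β-constant u v = *-cancelʳ-≡ (βAt G b u) (βAt G b v) (b ∸ a) {{>-nonZero (m<n⇒0<n∸m a<b)}}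
    (+-cancelˡ-≡ (∑[ x < n ] a) _ _ (+-cancelʳ-≡ (1 * (k ∸ a)) _ _ (begin
      ∑[ x < n ] a + βAt G b u * (b ∸ a) + 1 * (k ∸ a)  ≡⟨ ∑-common-decomposition u ⟨
      ∑[ x < n ] common G x u                          ≡⟨ ∑-common regular u ⟩
      k * k                                            ≡⟨ ∑-common regular v ⟨
      ∑[ x < n ] common G x v                          ≡⟨ ∑-common-decomposition v ⟩
      ∑[ x < n ] a + βAt G b v * (b ∸ a) + 1 * (k ∸ a)  ∎)))

module TwinClasses {n} (G : Graph n) {k b a} (deza : IsDeza G k b a)
                   (k≡1+b : k ≡ suc b) (typeB : ∀ v → TypeB G b v) where
  open Graph G renaming (sym to adj-sym)
  open GraphProperties G

  private
    dichotomy : ∀ u v → u ≢ v → common G u v ≡ b ⊎ common G u v ≡ a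
    dichotomy = proj₂ (proj₂ (proj₂ deza))

    degree≡1+b : ∀ v → degree G v ≡ suc b
    degree≡1+b v = trans (proj₁ (proj₂ deza) v) k≡1+b

    common-self≢b : ∀ v → common G v v ≢ b
    common-self≢b v vv≡b = 1+n≢n (trans (sym (degree≡1+b v)) (trans (sym (common-self v)) vv≡b))

    common≡b⇒adj : ∀ {u v} → common G u v ≡ b → adj u v ≡ true
    common≡b⇒adj {u} {v} uv≡b = trans (adj-sym u v) (typeB v u uv≡b)

  B[_] : Fin n → Fin n → Bool
  B[ u ] w = does (w ≟ u) ∨ inB G b u w

  B[]⇒twins : ∀ {u w} → B[ u ] w ≡ true → Twins u w
  B[]⇒twins {u} {w} w∈B[u] with w ≟ u
  ... | yes refl = λ _ → refl
  ... | no  _    = degree≡1+common⇒twins (typeB u w wu≡b) (degree≡1+common u) (degree≡1+common w)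
    where
    wu≡b : common G w u ≡ b
    wu≡b = Equivalence.to (inB⇔ b u w) w∈B[u]

    degree≡1+common : ∀ v → degree G v ≡ suc (common G w u)
    degree≡1+common v = trans (degree≡1+b v) (cong suc (sym wu≡b))

  twins⇒B[] : ∀ {u w} → Twins u w → B[ u ] w ≡ true
  twins⇒B[] {u} {w} twins with w ≟ u
  ... | yes refl = refl
  ... | no  w≢u  = Equivalence.from (inB⇔ b u w)
    (suc-injective (trans (sym (twins⇒degree≡1+common twins (w≢u ∘ sym))) (degree≡1+b u)))

  B[]-closed : ∀ u → Closed B[_] B[ u ]
  B[]-closed u {w} {w′} w′∈B[w] = ⇔→≡ (mk⇔
    (λ w∈B[u]  → twins⇒B[] (λ x → trans (B[]⇒twins w∈B[u] x) (w≈w′ x)))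
    (λ w′∈B[u] → twins⇒B[] (λ x → trans (B[]⇒twins w′∈B[u] x) (sym (w≈w′ x)))))
    where
    w≈w′ : Twins w w′
    w≈w′ = B[]⇒twins w′∈B[w]

  N[]∧N[]-closed : ∀ p q → Closed B[_] (λ x → N[ p ] x ∧ N[ q ] x)
  N[]∧N[]-closed p q {w} {w′} w′∈B[w] = cong₂ _∧_ (same p) (same q)
    where
    same : ∀ r → N[ r ] w ≡ N[ r ] w′
    same r = trans (N[]-sym r w) (trans (B[]⇒twins w′∈B[w] r) (sym (N[]-sym r w′)))

  |B[]| : ∀ u → count B[ u ] ≡ suc (βAt G b u)
  |B[]| u = trans (count-∨-disjoint (λ w → does (w ≟ u)) (inB G b u) u∉B[u])
                  (cong (_+ βAt G b u) (count-≟ u))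
    where
    u∉B[u] : ∀ w → does (w ≟ u) ≡ true → inB G b u w ≡ false
    u∉B[u] w _ with w ≟ u
    ... | yes refl with inB G b w w in w∈Bw
    ...   | true  = contradiction (Equivalence.to (inB⇔ b w w) w∈Bw) (common-self≢b w)
    ...   | false = refl

  nonadjacent⇒a : ∀ {u v} → u ≢ v → adj u v ≡ false → common G u v ≡ a
  nonadjacent⇒a {u} {v} u≢v u≁v with dichotomy u v u≢v
  ... | inj₁ uv≡b = contradiction (trans (sym (common≡b⇒adj uv≡b)) u≁v) λ ()
  ... | inj₂ uv≡a = uv≡a

  nonadjacent⇒a<b : ∀ {u v} → u ≢ v → adj u v ≡ false → a < b
  nonadjacent⇒a<b {u} {v} u≢v u≁v = ≤∧≢⇒< (proj₁ (proj₂ (proj₂ deza))) λ a≡b →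
    contradiction (trans (sym (common≡b⇒adj (trans (nonadjacent⇒a u≢v u≁v) a≡b))) u≁v) λ ()

  1+β∣common : a < b → ∀ u {p q} → p ≢ q → suc (βAt G b u) ∣ indicator (adj p q) * 2 + common G p q
  1+β∣common a<b u {p} {q} p≢q = subst (suc (βAt G b u) ∣_) (count-N[]∧N[] p≢q)
    (∣-count-closed B[_] (λ v → twins⇒B[] λ _ → refl) B[]-closed |B[]|≡1+βu _ (N[]∧N[]-closed p q))
    where
    |B[]|≡1+βu : ∀ w → count B[ w ] ≡ suc (βAt G b u)
    |B[]|≡1+βu w = trans (|B[]| w) (cong suc (β-constant G deza a<b (subst (b <_) (sym k≡1+b) (n<1+n b)) w u))

lemma17 : (n k b a : ℕ) → (G : Graph n) →
    ¬ (IsStrictlyDeza G k b a × k ≡ suc b × (∀ v → 1 < βAt G b v) × (∀ v → TypeB G b v))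
lemma17 n k b a G ((deza , (_ , u₀ , v₀ , u₀≢v₀ , u₀≁v₀) , not-srg) , k≡1+b , β>1 , typeB) =
  not-srg (k , b , a , proj₁ (proj₂ deza) , λ u v u≢v → adjacent⇒b u≢v , nonadjacent⇒a u≢v)
  where
  open Graph G
  open TwinClasses G deza k≡1+b typeB

  c : ℕ
  c = suc (βAt G b u₀)

  c∣ : ∀ {p q} → p ≢ q → c ∣ indicator (adj p q) * 2 + common G p q
  c∣ = 1+β∣common (nonadjacent⇒a<b u₀≢v₀ u₀≁v₀) u₀

  c∣a : c ∣ a
  c∣a = subst (c ∣_) (trans (cong (λ x → indicator x * 2 + common G u₀ v₀) u₀≁v₀)
                            (nonadjacent⇒a u₀≢v₀ u₀≁v₀))
              (c∣ u₀≢v₀)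

  adjacent⇒b : ∀ {u v} → u ≢ v → adj u v ≡ true → common G u v ≡ b
  adjacent⇒b {u} {v} u≢v u~v with proj₂ (proj₂ (proj₂ deza)) u v u≢v
  ... | inj₁ uv≡b = uv≡b
  ... | inj₂ uv≡a = contradiction (∣⇒≤ c∣2) (<⇒≱ (s≤s (β>1 u₀)))
    where
    c∣a+2 : c ∣ a + 2
    c∣a+2 = subst (c ∣_) (trans (cong (λ x → indicator x * 2 + common G u v) u~v)
                                (trans (cong (2 +_) uv≡a) (+-comm 2 a)))
                  (c∣ u≢v)

    c∣2 : c ∣ 2
    c∣2 = ∣m+n∣m⇒∣n c∣a+2 c∣a
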